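{- Let $H$ be an $AB$ bipartite graph and $H^*$ its associated co-bipartite graph. If $H^*$ is not an interval graph, then \[\frac{\mathrm{box}(H^*)}{2}\le\mathrm{box}(H)\le\mathrm{box}(H^*).\] If $H^*$ is an interval graph, then $\mathrm{box}(H)\le 2$.
   Context: An $AB$ bipartite graph is a finite simple graph whose vertex set is partitioned into non-empty sets $A$ and $B$ each inducing an independent set. Its associated co-bipartite graph $H^*$ has the same vertex set, with $A$ and $B$ each made into cliques, and for $u\in A$, $v\in B$, $\{u,v\}\in E(H^*)$ iff $\{u,v\}\in E(H)$. An interval graph is a graph whose vertices can be assigned closed real intervals with adjacency iff intersection. The boxicity $\mathrm{box}(G)$ is the minimum $k$ such that vertices map to products of $k$ closed real intervals with adjacency iff intersection; complete graphs have boxicity $0$.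
   Formalization: The closed intervals in the definitions of interval graph and of boxicity have rational endpoints instead of real ones. -}

module Defs where

open import Data.Nat using (ℕ; _≤_)
open import Data.Fin using (Fin)
open import Data.Bool using (Bool; true; false)
open import Data.Rational using (ℚ) renaming (_≤_ to _≤ℚ_)
open import Data.Product using (_×_; ∃)
open import Data.Sum using (_⊎_)
open import Relation.Nullary using (¬_)
open import Relation.Binary.PropositionalEquality using (_≡_; _≢_)

record Graph (n : ℕ) : Set₁ where
  field
    Adj    : Fin n → Fin n → Set
    sym    : ∀ u v → Adj u v → Adj v u
    irrefl : ∀ u → ¬ Adj u u
open Graph public

-- An AB bipartite graph: vertices partitioned by `side` into
-- A = {side ≡ true} and B = {side ≡ false}, both non-empty and independent.
record ABBipartite (n : ℕ) : Set₁ where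
  field
    graph  : Graph n
    side   : Fin n → Bool
    A-nonempty : ∃ λ u → side u ≡ true
    B-nonempty : ∃ λ u → side u ≡ false
    indep  : ∀ u v → side u ≡ side v → ¬ Adj graph u v
open ABBipartite public

coAdj : ∀ {n} → ABBipartite n → Fin n → Fin n → Set
coAdj H u v = (u ≢ v) × (side H u ≡ side H v ⊎ Adj (graph H) u v)

coBipartite : ∀ {n} → ABBipartite n → Graph n
coBipartite H = record
  { Adj    = coAdj H
  ; sym    = λ u v p → symm u v p
  ; irrefl = λ u p → Data.Product.proj₁ p Relation.Binary.PropositionalEquality.refl
  }
  where
  open import Data.Product using (_,_; proj₁)
  open import Data.Sum using (inj₁; inj₂)
  open import Relation.Binary.PropositionalEquality using (refl) renaming (sym to ≡sym)
  symm : ∀ u v → coAdj H u v → coAdj H v u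
  symm u v (u≢v , inj₁ e) = (λ e′ → u≢v (≡sym e′)) , inj₁ (≡sym e)
  symm u v (u≢v , inj₂ a) = (λ e′ → u≢v (≡sym e′)) , inj₂ (Graph.sym (graph H) u v a)

Meets : ℚ → ℚ → ℚ → ℚ → Set
Meets a b c d = (a ≤ℚ d) × (c ≤ℚ b)

IsIntervalGraph : ∀ {n} → Graph n → Set
IsIntervalGraph {n} G =
  ∃ λ (lo : Fin n → ℚ) → ∃ λ (hi : Fin n → ℚ) →
    (∀ v → lo v ≤ℚ hi v) ×
    (∀ u v → u ≢ v →
       (Adj G u v → Meets (lo u) (hi u) (lo v) (hi v)) ×
       (Meets (lo u) (hi u) (lo v) (hi v) → Adj G u v))

HasBoxRep : ∀ {n} → Graph n → ℕ → Set
HasBoxRep {n} G k =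
  ∃ λ (lo : Fin n → Fin k → ℚ) → ∃ λ (hi : Fin n → Fin k → ℚ) →
    (∀ v i → lo v i ≤ℚ hi v i) ×
    (∀ u v → u ≢ v →
       (Adj G u v → ∀ i → Meets (lo u i) (hi u i) (lo v i) (hi v i)) ×
       ((∀ i → Meets (lo u i) (hi u i) (lo v i) (hi v i)) → Adj G u v))

IsBoxicity : ∀ {n} → Graph n → ℕ → Set
IsBoxicity G b = HasBoxRep G b × (∀ k → HasBoxRep G k → b ≤ k)

{-# OPTIONS --safe #-}
module Submission where

-- Given boxes for H, each coordinate is used twice: once with the A-intervals
-- stretched up to a common top and the B-intervals down to a common bottom,
-- once the other way round.  Both sides become cliques, and a crossing pair
-- meets in the two copies exactly when it met in the original coordinate;
-- hence box(H*) ≤ 2 box(H).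
--
-- Given boxes for H*, in each coordinate the A-intervals pairwise meet and so
-- share a point a (Helly in dimension one); likewise the B-intervals share a
-- point b.  Comparing a with b shows that a crossing pair meets in this
-- coordinate iff a single threshold inequality Y r ≤ X p holds, and such a
-- coordinate can be redrawn with the A-vertices as pairwise distinct points.
-- Doing this for A in one coordinate and for B in another makes both sides
-- independent without changing crossing pairs, so box(H) ≤ box(H*) as soon as
-- box(H*) ≥ 2, i.e. unless H* is an interval graph; in that case its interval
-- representation is first duplicated into two coordinates.

open import Defs
open import Data.Nat using (ℕ; _≤_; _*_)
open import Data.Product using (_×_)
open import Relation.Nullary using (¬_)

open import Data.Bool using (Bool; true; false; not; if_then_else_)
import Data.Bool.Properties as Bool
open import Data.Empty using (⊥-elim)
open import Data.Fin using (Fin; zero; suc; toℕ; combine; remQuot)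
import Data.Fin.Properties as Fin
open import Data.Nat using (zero; suc; _+_; _<_; z≤n; s≤s; NonZero)
import Data.Nat.Properties as ℕ
open import Data.Nat.DivMod using (_%_; [m+kn]%n≡m%n; m<n⇒m%n≡m)
import Data.Integer as ℤ
import Data.Integer.Properties as ℤ
open import Data.Rational using (ℚ; mkℚ; *≤*; -_; _⊔_; 0ℚ) renaming (_≤_ to _≤ℚ_; _<_ to _<ℚ_)
open import Data.Rational.Literals using (fromℤ)
import Data.Rational.Properties as ℚ
open import Data.Product using (∃; ∃₂; _,_; proj₁; proj₂; swap; map₂)
open import Data.Sum using (inj₁; inj₂)
open import Function.Base using (_∘_)
open import Function.Bundles using (_⇔_; mk⇔; Equivalence)
import Function.Properties.Equivalence as ⇔
open import Relation.Nullary using (yes; no; contradiction)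
open import Relation.Unary using (Decidable)
open import Relation.Binary.PropositionalEquality using (_≡_; _≢_; refl; subst; subst₂; cong; trans)
import Relation.Binary.PropositionalEquality as ≡

open Equivalence using (to; from)

neg-involutive : ∀ p → - (- p) ≡ p
neg-involutive (mkℚ (ℤ.+ zero)  _ _) = refl
neg-involutive (mkℚ (ℤ.+ suc _) _ _) = refl
neg-involutive (mkℚ ℤ.-[1+ _ ]  _ _) = refl

neg-cancel-≤ : ∀ {p q} → - p ≤ℚ - q → q ≤ℚ p
neg-cancel-≤ {p} {q} -p≤-q =
  subst₂ _≤ℚ_ (neg-involutive q) (neg-involutive p) (ℚ.neg-antimono-≤ -p≤-q)

meets-comm : ∀ {a b c d} → Meets a b c d ⇔ Meets c d a b
meets-comm = mk⇔ swap swap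

∀-⇔ : ∀ {I : Set} {A B : I → Set} → (∀ i → A i ⇔ B i) → (∀ i → A i) ⇔ (∀ i → B i)
∀-⇔ A⇔B = mk⇔ (λ a i → to (A⇔B i) (a i)) (λ b i → from (A⇔B i) (b i))

toℚ : ℕ → ℚ
toℚ n = fromℤ (ℤ.+ n)

toℚ-mono-≤ : ∀ {a b} → a ≤ b → toℚ a ≤ℚ toℚ b
toℚ-mono-≤ {a} {b} a≤b =
  *≤* (subst₂ ℤ._≤_ (≡.sym (ℤ.*-identityʳ (ℤ.+ a))) (≡.sym (ℤ.*-identityʳ (ℤ.+ b))) (ℤ.+≤+ a≤b))

toℚ-cancel-≤ : ∀ {a b} → toℚ a ≤ℚ toℚ b → a ≤ b
toℚ-cancel-≤ {a} {b} (*≤* p) =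
  ℤ.drop‿+≤+ (subst₂ ℤ._≤_ (ℤ.*-identityʳ (ℤ.+ a)) (ℤ.*-identityʳ (ℤ.+ b)) p)

toℚ-meets : ∀ {a b c d} → Meets (toℚ a) (toℚ b) (toℚ c) (toℚ d) ⇔ (a ≤ d × c ≤ b)
toℚ-meets = mk⇔ (λ (a≤d , c≤b) → toℚ-cancel-≤ a≤d , toℚ-cancel-≤ c≤b)
                (λ (a≤d , c≤b) → toℚ-mono-≤ a≤d , toℚ-mono-≤ c≤b)

-- Ranks move the values of z into {0, …, n} without changing how they
-- compare with any x.
rank : ∀ {n} → (Fin n → ℚ) → ℚ → ℕ
rank {zero}  z x = 0
rank {suc n} z x with z zero ℚ.≤? x
... | yes _ = suc (rank (z ∘ suc) x)
... | no  _ = rank (z ∘ suc) x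

rank≤n : ∀ {n} (z : Fin n → ℚ) x → rank z x ≤ n
rank≤n {zero}  z x = z≤n
rank≤n {suc n} z x with z zero ℚ.≤? x
... | yes _ = s≤s (rank≤n (z ∘ suc) x)
... | no  _ = ℕ.m≤n⇒m≤1+n (rank≤n (z ∘ suc) x)

rank-mono-≤ : ∀ {n} (z : Fin n → ℚ) {x y} → x ≤ℚ y → rank z x ≤ rank z y
rank-mono-≤ {zero}  z x≤y = z≤n
rank-mono-≤ {suc n} z {x} {y} x≤y with z zero ℚ.≤? x | z zero ℚ.≤? y
... | yes _    | yes _    = s≤s (rank-mono-≤ (z ∘ suc) x≤y)
... | yes z₀≤x | no  z₀≰y = contradiction (ℚ.≤-trans z₀≤x x≤y) z₀≰y
... | no  _    | yes _    = ℕ.m≤n⇒m≤1+n (rank-mono-≤ (z ∘ suc) x≤y)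
... | no  _    | no  _    = rank-mono-≤ (z ∘ suc) x≤y

rank-mono-< : ∀ {n} (z : Fin n → ℚ) u {x y} → x <ℚ z u → z u ≤ℚ y → rank z x < rank z y
rank-mono-< {suc n} z zero {x} {y} x<z₀ z₀≤y with z zero ℚ.≤? x | z zero ℚ.≤? y
... | yes z₀≤x | _        = contradiction (ℚ.<-≤-trans x<z₀ z₀≤x) (ℚ.<-irrefl refl)
... | no  _    | no  z₀≰y = contradiction z₀≤y z₀≰y
... | no  _    | yes _    = s≤s (rank-mono-≤ (z ∘ suc) (ℚ.≤-trans (ℚ.<⇒≤ x<z₀) z₀≤y))
rank-mono-< {suc n} z (suc u) {x} {y} x<zu zu≤y with z zero ℚ.≤? x | z zero ℚ.≤? y
... | yes _    | yes _    = s≤s (rank-mono-< (z ∘ suc) u x<zu zu≤y)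
... | yes z₀≤x | no  z₀≰y = contradiction (ℚ.≤-trans z₀≤x (ℚ.≤-trans (ℚ.<⇒≤ x<zu) zu≤y)) z₀≰y
... | no  _    | yes _    = ℕ.m<n⇒m<1+n (rank-mono-< (z ∘ suc) u x<zu zu≤y)
... | no  _    | no  _    = rank-mono-< (z ∘ suc) u x<zu zu≤y

rank-cancel-≤ : ∀ {n} (z : Fin n → ℚ) u x → rank z (z u) ≤ rank z x → z u ≤ℚ x
rank-cancel-≤ z u x ρ≤ρ with z u ℚ.≤? x
... | yes zu≤x = zu≤x
... | no  zu≰x = contradiction ρ≤ρ (ℕ.<⇒≱ (rank-mono-< z u (ℚ.≰⇒> zu≰x) ℚ.≤-refl))

*-+-cancel-≤ : ∀ {a b m t} → t < m → a * m ≤ b * m + t → a ≤ b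
*-+-cancel-≤ {a} {b} {m} {t} t<m am≤bm+t with a ℕ.≤? b
... | yes a≤b = a≤b
... | no  a≰b = contradiction am≤bm+t (ℕ.<⇒≱ (begin-strict
  b * m + t  <⟨ ℕ.+-monoʳ-< (b * m) t<m ⟩
  b * m + m  ≡⟨ ℕ.+-comm (b * m) m ⟩
  suc b * m  ≤⟨ ℕ.*-monoˡ-≤ m (ℕ.≰⇒> a≰b) ⟩
  a * m      ∎))
  where open ℕ.≤-Reasoning

*-+-injectiveʳ : ∀ {a b m t t′} .{{_ : NonZero m}} → t < m → t′ < m →
                 a * m + t ≡ b * m + t′ → t ≡ t′
*-+-injectiveʳ {a} {b} {m} {t} {t′} t<m t′<m eq = begin
  t                ≡⟨ m<n⇒m%n≡m t<m ⟨
  t % m            ≡⟨ [m+kn]%n≡m%n t a m ⟨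
  (t + a * m) % m  ≡⟨ cong (_% m) (ℕ.+-comm t (a * m)) ⟩
  (a * m + t) % m  ≡⟨ cong (_% m) eq ⟩
  (b * m + t′) % m ≡⟨ cong (_% m) (ℕ.+-comm (b * m) t′) ⟩
  (t′ + b * m) % m ≡⟨ [m+kn]%n≡m%n t′ b m ⟩
  t′ % m           ≡⟨ m<n⇒m%n≡m t′<m ⟩
  t′               ∎
  where open ≡.≡-Reasoning

sup : ∀ {n} → (Fin n → ℚ) → ℚ → ℚ
sup {zero}  f b = b
sup {suc n} f b = f zero ⊔ sup (f ∘ suc) b

≤-sup : ∀ {n} (f : Fin n → ℚ) b w → f w ≤ℚ sup f b
≤-sup f b zero    = ℚ.p≤p⊔q (f zero) _
≤-sup f b (suc w) = ℚ.p≤q⇒p≤r⊔q (f zero) (≤-sup (f ∘ suc) b w)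

sup-lub : ∀ {n} (f : Fin n → ℚ) {b c} → b ≤ℚ c → (∀ w → f w ≤ℚ c) → sup f b ≤ℚ c
sup-lub {zero}  f b≤c f≤c = b≤c
sup-lub {suc n} f b≤c f≤c = ℚ.⊔-lub (f≤c zero) (sup-lub (f ∘ suc) b≤c (f≤c ∘ suc))

intervals-helly : ∀ {n} {P : Fin n → Set} → Decidable P → (lo hi : Fin n → ℚ) → ∃ P →
                  (∀ u v → P u → P v → lo u ≤ℚ hi v) →
                  ∃ λ a → ∀ u → P u → lo u ≤ℚ a × a ≤ℚ hi u
intervals-helly {n} {P} P? lo hi (w₀ , P-w₀) pairwise =
  sup loP (lo w₀) ,
  λ u Pu → ℚ.≤-trans (lo≤loP u Pu) (≤-sup loP (lo w₀) u) ,
           sup-lub loP (pairwise w₀ u P-w₀ Pu) (λ w → loP≤hi w u Pu)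
  where
  -- vertices outside P take the value at w₀, so the supremum only sees P
  loP : Fin n → ℚ
  loP w with P? w
  ... | yes _ = lo w
  ... | no  _ = lo w₀

  lo≤loP : ∀ u → P u → lo u ≤ℚ loP u
  lo≤loP u Pu with P? u
  ... | yes _   = ℚ.≤-refl
  ... | no  ¬Pu = contradiction Pu ¬Pu

  loP≤hi : ∀ w u → P u → loP w ≤ℚ hi u
  loP≤hi w u Pu with P? w
  ... | yes Pw = pairwise w u Pw Pu
  ... | no  _  = pairwise w₀ u P-w₀ Pu

-- With a common point a of the true-intervals and b of the false-intervals,
-- one of the two inequalities in Meets holds for every crossing pair, and
-- which one depends only on whether a ≤ b.
cliques-cross-threshold :
  ∀ {n} (S : Fin n → Bool) (lo hi : Fin n → ℚ) →
  ∃ (λ u → S u ≡ true) → ∃ (λ u → S u ≡ false) →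
  (∀ u v → S u ≡ S v → lo u ≤ℚ hi v) →
  ∃₂ λ X Y → ∀ p r → S p ≡ true → S r ≡ false →
    Meets (lo p) (hi p) (lo r) (hi r) ⇔ (Y r ≤ℚ X p)
cliques-cross-threshold S lo hi trues falses cliques
  with intervals-helly (λ w → S w Bool.≟ true) lo hi trues
         (λ u v su sv → cliques u v (trans su (≡.sym sv)))
     | intervals-helly (λ w → S w Bool.≟ false) lo hi falses
         (λ u v su sv → cliques u v (trans su (≡.sym sv)))
... | a , a-common | b , b-common with a ℚ.≤? b
...   | yes a≤b = hi , lo , λ p r sp sr → mk⇔ proj₂ λ lo-r≤hi-p →
          ℚ.≤-trans (proj₁ (a-common p sp)) (ℚ.≤-trans a≤b (proj₂ (b-common r sr))) , lo-r≤hi-p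
...   | no  a≰b = -_ ∘ lo , -_ ∘ hi , λ p r sp sr → mk⇔ (ℚ.neg-antimono-≤ ∘ proj₁) λ -hi-r≤-lo-p →
          neg-cancel-≤ -hi-r≤-lo-p ,
          ℚ.≤-trans (proj₁ (b-common r sr)) (ℚ.≤-trans (ℚ.<⇒≤ (ℚ.≰⇒> a≰b)) (proj₂ (a-common p sp)))

-- Stretching the true-intervals up to n and the false-intervals down to 0
-- makes each side a clique and leaves only lo p ≤ hi r to decide whether a
-- crossing pair meets.
module CoBipartiteClosure {n} (S : Fin n → Bool) (lo hi : Fin n → ℚ) where

  left right : Fin n → ℚ
  left  w = toℚ (if S w then rank lo (lo w) else 0)
  right w = toℚ (if S w then n else rank lo (hi w))

  left≤right : ∀ w → left w ≤ℚ right w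
  left≤right w with S w
  ... | true  = toℚ-mono-≤ (rank≤n lo (lo w))
  ... | false = toℚ-mono-≤ z≤n

  sameSide-meet : ∀ b u v → S u ≡ b → S v ≡ b → Meets (left u) (right u) (left v) (right v)
  sameSide-meet true  u v su sv rewrite su | sv =
    toℚ-mono-≤ (rank≤n lo (lo u)) , toℚ-mono-≤ (rank≤n lo (lo v))
  sameSide-meet false u v su sv rewrite su | sv = toℚ-mono-≤ z≤n , toℚ-mono-≤ z≤n

  cross-meet : ∀ p r → S p ≡ true → S r ≡ false →
               Meets (left p) (right p) (left r) (right r) ⇔ (lo p ≤ℚ hi r)
  cross-meet p r sp sr rewrite sp | sr = ⇔.trans toℚ-meets
    (mk⇔ (λ (ρ≤ρ , _) → rank-cancel-≤ lo p (hi r) ρ≤ρ) (λ lo≤hi → rank-mono-≤ lo lo≤hi , z≤n))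

-- True-vertices become points, placed in lexicographic order of
-- (rank of X, index) so that they are pairwise distinct; false-vertices
-- become intervals reaching from the rank of Y up to a common top.
module ThresholdPoints {n} (S : Fin n → Bool) (X Y : Fin n → ℚ) where

  m : ℕ
  m = suc n

  point : Fin n → ℕ
  point w = rank Y (X w) * m + toℕ w

  top : ℕ
  top = n * m + m

  left right : Fin n → ℚ
  left  w = toℚ (if S w then point w else rank Y (Y w) * m)
  right w = toℚ (if S w then point w else top)

  toℕ<m : ∀ w → toℕ w < m
  toℕ<m w = ℕ.m<n⇒m<1+n (Fin.toℕ<n w)

  point≤top : ∀ w → point w ≤ top
  point≤top w = ℕ.+-mono-≤ (ℕ.*-monoˡ-≤ m (rank≤n Y (X w))) (ℕ.<⇒≤ (toℕ<m w))

  left≤right : ∀ w → left w ≤ℚ right w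
  left≤right w with S w
  ... | true  = ℚ.≤-refl
  ... | false = toℚ-mono-≤ (ℕ.≤-trans (ℕ.*-monoˡ-≤ m (rank≤n Y (Y w))) (ℕ.m≤m+n (n * m) m))

  cross-meet : ∀ p r → S p ≡ true → S r ≡ false →
               Meets (left p) (right p) (left r) (right r) ⇔ (Y r ≤ℚ X p)
  cross-meet p r sp sr rewrite sp | sr = ⇔.trans toℚ-meets (mk⇔
    (λ (_ , below) → rank-cancel-≤ Y r (X p) (*-+-cancel-≤ (toℕ<m p) below))
    (λ Yr≤Xp → point≤top p ,
               ℕ.≤-trans (ℕ.*-monoˡ-≤ m (rank-mono-≤ Y Yr≤Xp)) (ℕ.m≤m+n _ (toℕ p))))

  points-disjoint : ∀ p q → S p ≡ true → S q ≡ true →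
                    Meets (left p) (right p) (left q) (right q) → p ≡ q
  points-disjoint p q sp sq rewrite sp | sq = λ meet →
    let (p≤q , q≤p) = to toℚ-meets meet in
    Fin.toℕ-injective (*-+-injectiveʳ {rank Y (X p)} {rank Y (X q)}
                         (toℕ<m p) (toℕ<m q) (ℕ.≤-antisym p≤q q≤p))

record PointSeparation {n} (S : Fin n → Bool) (lo hi : Fin n → ℚ) : Set where
  field
    left right : Fin n → ℚ
    left≤right : ∀ w → left w ≤ℚ right w
    cross-meet : ∀ p r → S p ≡ true → S r ≡ false →
                 Meets (left p) (right p) (left r) (right r) ⇔ Meets (lo p) (hi p) (lo r) (hi r)
    points-disjoint : ∀ p q → S p ≡ true → S q ≡ true →
                      Meets (left p) (right p) (left q) (right q) → p ≡ q

separate-points : ∀ {n} (S : Fin n → Bool) (lo hi : Fin n → ℚ) →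
                  ∃ (λ u → S u ≡ true) → ∃ (λ u → S u ≡ false) →
                  (∀ u v → S u ≡ S v → lo u ≤ℚ hi v) → PointSeparation S lo hi
separate-points S lo hi trues falses cliques
  with cliques-cross-threshold S lo hi trues falses cliques
... | X , Y , threshold = record
  { left            = left
  ; right           = right
  ; left≤right      = left≤right
  ; cross-meet      = λ p r sp sr → ⇔.trans (cross-meet p r sp sr) (⇔.sym (threshold p r sp sr))
  ; points-disjoint = points-disjoint
  }
  where open ThresholdPoints S X Y

BoxesMeet : ∀ {n} {I : Set} → (lo hi : Fin n → I → ℚ) → Fin n → Fin n → Set
BoxesMeet lo hi u v = ∀ i → Meets (lo u i) (hi u i) (lo v i) (hi v i)

boxesMeet-sym : ∀ {n} {I : Set} {lo hi : Fin n → I → ℚ} {u v} →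
                BoxesMeet lo hi u v → BoxesMeet lo hi v u
boxesMeet-sym meet = swap ∘ meet

Agrees : ∀ {n} → Graph n → (Fin n → Fin n → Set) → Fin n → Fin n → Set
Agrees G M u v = u ≢ v → (Adj G u v → M u v) × (M u v → Adj G u v)

agrees-sym : ∀ {n} (G : Graph n) {M : Fin n → Fin n → Set} → (∀ {u v} → M u v → M v u) →
             ∀ {u v} → Agrees G M u v → Agrees G M v u
agrees-sym G M-sym {u} {v} agrees v≢u =
  let (adj⇒M , M⇒adj) = agrees (v≢u ∘ ≡.sym) in
  M-sym ∘ adj⇒M ∘ Graph.sym G v u , Graph.sym G u v ∘ M⇒adj ∘ M-sym

Represents : ∀ {n} → Graph n → (Fin n → Fin n → Set) → Set
Represents G M = ∀ u v → Agrees G M u v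

-- HasBoxRep G k is definitionally BoxRep G (Fin k).
BoxRep : ∀ {n} → Graph n → Set → Set
BoxRep {n} G I = ∃ λ (lo : Fin n → I → ℚ) → ∃ λ (hi : Fin n → I → ℚ) →
  (∀ v i → lo v i ≤ℚ hi v i) × Represents G (BoxesMeet lo hi)

reindex : ∀ {n} {G : Graph n} {I J : Set} (f : J → I) → (∀ i → ∃ λ j → f j ≡ i) →
          BoxRep G I → BoxRep G J
reindex f f-onto (lo , hi , lo≤hi , rep) =
  (λ v → lo v ∘ f) , (λ v → hi v ∘ f) , (λ v → lo≤hi v ∘ f) ,
  λ u v u≢v → (λ adj → proj₁ (rep u v u≢v) adj ∘ f) ,
              (λ meet → proj₂ (rep u v u≢v) λ i →
                 let (j , fj≡i) = f-onto i in
                 subst (λ i → Meets (lo u i) (hi u i) (lo v i) (hi v i)) fj≡i (meet j))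

interval⇒box₁ : ∀ {n} {G : Graph n} → IsIntervalGraph G → HasBoxRep G 1
interval⇒box₁ (lo , hi , lo≤hi , rep) =
  (λ v _ → lo v) , (λ v _ → hi v) , (λ v _ → lo≤hi v) ,
  λ u v u≢v → (λ adj _ → proj₁ (rep u v u≢v) adj) , (λ meet → proj₂ (rep u v u≢v) (meet zero))

box₁⇒interval : ∀ {n} {G : Graph n} → HasBoxRep G 1 → IsIntervalGraph G
box₁⇒interval (lo , hi , lo≤hi , rep) =
  (λ v → lo v zero) , (λ v → hi v zero) , (λ v → lo≤hi v zero) ,
  λ u v u≢v → (λ adj → proj₁ (rep u v u≢v) adj zero) ,
              (λ meet → proj₂ (rep u v u≢v) λ { zero → meet })

box₀⇒interval : ∀ {n} {G : Graph n} → HasBoxRep G 0 → IsIntervalGraph G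
box₀⇒interval (_ , _ , _ , rep) =
  (λ _ → 0ℚ) , (λ _ → 0ℚ) , (λ _ → ℚ.≤-refl) ,
  λ u v u≢v → (λ _ → ℚ.≤-refl , ℚ.≤-refl) , (λ _ → proj₂ (rep u v u≢v) λ ())

module _ {n} (H : ABBipartite n) where

  by-sides : {P : Fin n → Fin n → Set} → (∀ {u v} → P u v → P v u) →
             (∀ u v → side H u ≡ side H v → P u v) →
             (∀ p r → side H p ≡ true → side H r ≡ false → P p r) →
             ∀ u v → P u v
  by-sides P-sym same cross u v with side H u in su | side H v in sv
  ... | true  | true  = same u v (trans su (≡.sym sv))
  ... | false | false = same u v (trans su (≡.sym sv))
  ... | true  | false = cross u v su sv
  ... | false | true  = P-sym (cross v u sv su)

  cross-≢ : ∀ {p r} → side H p ≡ true → side H r ≡ false → p ≢ r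
  cross-≢ sp sr refl with () ← trans (≡.sym sp) sr

  coAdj⇔Adj : ∀ {p r} → side H p ≡ true → side H r ≡ false → coAdj H p r ⇔ Adj (graph H) p r
  coAdj⇔Adj {p} {r} sp sr = mk⇔ from-coAdj λ adj → cross-≢ sp sr , inj₂ adj
    where
    from-coAdj : coAdj H p r → Adj (graph H) p r
    from-coAdj (_ , inj₁ same) with () ← trans (≡.sym sp) (trans same sr)
    from-coAdj (_ , inj₂ adj)  = adj

  CrossAgree : (Fin n → Fin n → Set) → Set
  CrossAgree M = ∀ p r → side H p ≡ true → side H r ≡ false → Adj (graph H) p r ⇔ M p r

  represents-graph : {M : Fin n → Fin n → Set} → (∀ {u v} → M u v → M v u) → CrossAgree M →
                     (∀ u v → u ≢ v → side H u ≡ side H v → ¬ M u v) → Represents (graph H) M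
  represents-graph {M} M-sym agree separated = by-sides (agrees-sym (graph H) M-sym) same cross
    where
    same : ∀ u v → side H u ≡ side H v → Agrees (graph H) M u v
    same u v su≡sv u≢v = (λ adj → ⊥-elim (indep H u v su≡sv adj)) ,
                         (λ meet → ⊥-elim (separated u v u≢v su≡sv meet))
    cross : ∀ p r → side H p ≡ true → side H r ≡ false → Agrees (graph H) M p r
    cross p r sp sr _ = to (agree p r sp sr) , from (agree p r sp sr)

  represents-coBipartite : {M : Fin n → Fin n → Set} → (∀ {u v} → M u v → M v u) → CrossAgree M →
                           (∀ u v → side H u ≡ side H v → M u v) → Represents (coBipartite H) M
  represents-coBipartite {M} M-sym agree together =
    by-sides (agrees-sym (coBipartite H) M-sym) same cross
    where
    same : ∀ u v → side H u ≡ side H v → Agrees (coBipartite H) M u v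
    same u v su≡sv u≢v = (λ _ → together u v su≡sv) , (λ _ → u≢v , inj₁ su≡sv)
    cross : ∀ p r → side H p ≡ true → side H r ≡ false → Agrees (coBipartite H) M p r
    cross p r sp sr _ = let e = ⇔.trans (coAdj⇔Adj sp sr) (agree p r sp sr) in to e , from e

  crossAgree-graph : {M : Fin n → Fin n → Set} → Represents (graph H) M → CrossAgree M
  crossAgree-graph rep p r sp sr = let (adj⇒M , M⇒adj) = rep p r (cross-≢ sp sr) in mk⇔ adj⇒M M⇒adj

  crossAgree-coBipartite : {M : Fin n → Fin n → Set} → Represents (coBipartite H) M → CrossAgree M
  crossAgree-coBipartite rep p r sp sr =
    let (coAdj⇒M , M⇒coAdj) = rep p r (cross-≢ sp sr) in
    ⇔.trans (⇔.sym (coAdj⇔Adj sp sr)) (mk⇔ coAdj⇒M M⇒coAdj)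

bipartite⇒coBipartite-box : ∀ {n} (H : ABBipartite n) {I : Set} →
                            BoxRep (graph H) I → BoxRep (coBipartite H) (Fin 2 × I)
bipartite⇒coBipartite-box {n} H {I} (lo , hi , lo≤hi , rep) =
  left , right , (λ v (t , i) → C.left≤right t i v) ,
  represents-coBipartite H (boxesMeet-sym {lo = left} {hi = right}) agree together
  where
  sides : Fin 2 → Fin n → Bool
  sides zero       = side H
  sides (suc zero) = not ∘ side H

  module C (t : Fin 2) (i : I) = CoBipartiteClosure (sides t) (λ v → lo v i) (λ v → hi v i)

  left right : Fin n → Fin 2 × I → ℚ
  left  v (t , i) = C.left t i v
  right v (t , i) = C.right t i v

  together : ∀ u v → side H u ≡ side H v → BoxesMeet left right u v
  together u v su≡sv (zero , i)     = C.sameSide-meet zero i _ u v su≡sv refl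
  together u v su≡sv (suc zero , i) = C.sameSide-meet (suc zero) i _ u v (cong not su≡sv) refl

  cross-meets : ∀ p r → side H p ≡ true → side H r ≡ false →
                BoxesMeet left right p r ⇔ BoxesMeet lo hi p r
  cross-meets p r sp sr = mk⇔
    (λ meet i → to (A-first i) (meet (zero , i)) , to (B-first i) (swap (meet (suc zero , i))))
    λ { meet (zero , i) → from (A-first i) (proj₁ (meet i))
      ; meet (suc zero , i) → swap (from (B-first i) (proj₂ (meet i))) }
    where
    A-first : ∀ i → Meets (left p (zero , i)) (right p (zero , i)) (left r (zero , i)) (right r (zero , i))
                    ⇔ (lo p i ≤ℚ hi r i)
    A-first i = C.cross-meet zero i p r sp sr
    B-first : ∀ i → Meets (left r (suc zero , i)) (right r (suc zero , i))
                          (left p (suc zero , i)) (right p (suc zero , i))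
                    ⇔ (lo r i ≤ℚ hi p i)
    B-first i = C.cross-meet (suc zero) i r p (cong not sr) (cong not sp)

  agree : CrossAgree H (BoxesMeet left right)
  agree p r sp sr = ⇔.trans (crossAgree-graph H rep p r sp sr) (⇔.sym (cross-meets p r sp sr))

coBipartite⇒bipartite-box : ∀ {n} (H : ABBipartite n) {k} →
                            HasBoxRep (coBipartite H) (2 + k) → HasBoxRep (graph H) (2 + k)
coBipartite⇒bipartite-box {n} H {k} (lo , hi , lo≤hi , rep) =
  left , right , left≤right ,
  represents-graph H (boxesMeet-sym {lo = left} {hi = right}) agree separated
  where
  sameSide-≤ : ∀ i u v → side H u ≡ side H v → lo u i ≤ℚ hi v i
  sameSide-≤ i u v su≡sv with u Fin.≟ v
  ... | yes refl = lo≤hi u i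
  ... | no  u≢v  = proj₁ (proj₁ (rep u v u≢v) (u≢v , inj₁ su≡sv) i)

  sepA : PointSeparation (side H) (λ v → lo v zero) (λ v → hi v zero)
  sepA = separate-points (side H) _ _ (A-nonempty H) (B-nonempty H) (sameSide-≤ zero)

  sepB : PointSeparation (not ∘ side H) (λ v → lo v (suc zero)) (λ v → hi v (suc zero))
  sepB = separate-points (not ∘ side H) _ _
           (map₂ (cong not) (B-nonempty H)) (map₂ (cong not) (A-nonempty H))
           (λ u v e → sameSide-≤ (suc zero) u v (Bool.not-injective e))

  module A = PointSeparation sepA
  module B = PointSeparation sepB

  left right : Fin n → Fin (2 + k) → ℚ
  left  v zero            = A.left v
  left  v (suc zero)      = B.left v
  left  v i@(suc (suc _)) = lo v i
  right v zero            = A.right v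
  right v (suc zero)      = B.right v
  right v i@(suc (suc _)) = hi v i

  left≤right : ∀ v i → left v i ≤ℚ right v i
  left≤right v zero            = A.left≤right v
  left≤right v (suc zero)      = B.left≤right v
  left≤right v i@(suc (suc _)) = lo≤hi v i

  cross-meets : ∀ p r → side H p ≡ true → side H r ≡ false →
                BoxesMeet left right p r ⇔ BoxesMeet lo hi p r
  cross-meets p r sp sr = ∀-⇔ λ where
    zero          → A.cross-meet p r sp sr
    (suc zero)    → ⇔.trans meets-comm
                      (⇔.trans (B.cross-meet r p (cong not sr) (cong not sp)) meets-comm)
    (suc (suc _)) → ⇔.refl

  agree : CrossAgree H (BoxesMeet left right)
  agree p r sp sr = ⇔.trans (crossAgree-coBipartite H rep p r sp sr) (⇔.sym (cross-meets p r sp sr))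

  separated : ∀ u v → u ≢ v → side H u ≡ side H v → ¬ BoxesMeet left right u v
  separated u v u≢v su≡sv meet with side H v in sv
  ... | true  = u≢v (A.points-disjoint u v su≡sv sv (meet zero))
  ... | false = u≢v (B.points-disjoint u v (cong not su≡sv) (cong not sv) (meet (suc zero)))

bipartite⇒coBipartite-box₂ₖ : ∀ {n} (H : ABBipartite n) {k} →
                              HasBoxRep (graph H) k → HasBoxRep (coBipartite H) (2 * k)
bipartite⇒coBipartite-box₂ₖ H {k} =
  reindex {G = coBipartite H} (remQuot k) (λ (t , i) → combine t i , Fin.remQuot-combine t i)
  ∘ bipartite⇒coBipartite-box H

nonInterval-coBipartite⇒bipartite-box : ∀ {n} (H : ABBipartite n) {k} →
  ¬ IsIntervalGraph (coBipartite H) → HasBoxRep (coBipartite H) k → HasBoxRep (graph H) k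
nonInterval-coBipartite⇒bipartite-box H {zero} ¬interval box =
  contradiction (box₀⇒interval {G = coBipartite H} box) ¬interval
nonInterval-coBipartite⇒bipartite-box H {suc zero} ¬interval box =
  contradiction (box₁⇒interval {G = coBipartite H} box) ¬interval
nonInterval-coBipartite⇒bipartite-box H {suc (suc k)} _ box = coBipartite⇒bipartite-box H box

interval-coBipartite⇒bipartite-box₂ : ∀ {n} (H : ABBipartite n) →
  IsIntervalGraph (coBipartite H) → HasBoxRep (graph H) 2
interval-coBipartite⇒bipartite-box₂ H =
  coBipartite⇒bipartite-box H
  ∘ reindex {G = coBipartite H} (λ _ → zero) (λ { zero → zero , refl })
  ∘ interval⇒box₁ {G = coBipartite H}

lemma6 : ∀ {n} (H : ABBipartite n) (b b* : ℕ) →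
    IsBoxicity (graph H) b → IsBoxicity (coBipartite H) b* →
    (¬ IsIntervalGraph (coBipartite H) → (b* ≤ 2 * b) × (b ≤ b*)) ×
    (IsIntervalGraph (coBipartite H) → b ≤ 2)
lemma6 H b b* (box , minimal) (box* , minimal*) =
  (λ ¬interval → minimal* (2 * b) (bipartite⇒coBipartite-box₂ₖ H box) ,
                 minimal b* (nonInterval-coBipartite⇒bipartite-box H ¬interval box*)) ,
  (λ interval → minimal 2 (interval-coBipartite⇒bipartite-box₂ H interval))
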